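{- Every nonempty open subset $U$ of $\mathcal{M}$ (in the mutation class topology) is dense, i.e., its closure is all of $\mathcal{M}$.
   Context: A quiver is a finite directed multigraph (with at least one vertex) without loops and without oriented 2-cycles, with vertices labeled $1,\dots,n$. For a vertex $k$, the mutation $\mu_k(Q)$ is obtained by: (1) for each oriented path $i\to k\to j$ adding an arrow $i\to j$; (2) reversing all arrows incident to $k$; (3) removing a maximal collection of pairwise-disjoint oriented 2-cycles created. Two quivers are mutation-equivalent if one is isomorphic to a quiver obtained from the other by a finite sequence of mutations; the mutation class $[Q]$ is the equivalence class of $Q$. For $I\subseteq[n]$, the full subquiver $Q_I$ has vertex set $I$ and all arrows of $Q$ between vertices of $I$. A mutation class $[P]$ embeds into $[Q]$, written $[P]\preceq[Q]$, if some $P'\in[P]$ is isomorphic to a full subquiver of some $Q'\in[Q]$; this is a partial order on the set $\mathcal{M}$ of all mutation classes. The mutation class topology on $\mathcal{M}$ is the Alexandrov topology of $\preceq$: closed sets are the down-sets (if $[Q]\in S$ and $[P]\preceq[Q]$ then $[P]\in S$), open sets are the up-sets. The closure of $A\subseteq\mathcal{M}$ is the intersection of all closed sets containing $A$ (equivalently, the down-set generated by $A$); $A$ is dense if its closure is $\mathcal{M}$. -}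

module Defs where

open import Data.Nat using (ℕ; zero; suc; _+_; _*_; _∸_; _≤_)
open import Data.Nat.Properties using (n∸n≡0; m≤n⇒m∸n≡0; ≤-total)
open import Data.Fin using (Fin; _≟_)
open import Data.Sum using (_⊎_; inj₁; inj₂)
open import Data.Product using (Σ; _×_; _,_; ∃)
open import Relation.Nullary using (yes; no)
open import Relation.Binary.PropositionalEquality using (_≡_; refl)
open import Function.Definitions using (Injective)
open import Function.Bundles using (_⤖_; Bijection)

-- A quiver with vertices 1..nv (encoded as Fin nv), nv ≥ 1, given by its
-- arrow multiplicities: arr i j = number of arrows i → j.
record Quiver : Set where
  field
    nv       : ℕ
    nonempty : 1 ≤ nv
    arr      : Fin nv → Fin nv → ℕ
    loopfree : ∀ i → arr i i ≡ 0
    no2cyc   : ∀ i j → arr i j ≡ 0 ⊎ arr j i ≡ 0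
open Quiver public

-- Mutation at k on arrow multiplicities:
--  * arrows incident to k are reversed;
--  * for i, j ≠ k, step (1) adds arr i k * arr k j arrows i → j, and then
--    a maximal collection of 2-cycles between i and j is removed, leaving
--    (arr i j + arr i k * arr k j) ∸ (arr j i + arr j k * arr k i) arrows i → j.
mutArr : ∀ {n} → (Fin n → Fin n → ℕ) → Fin n → Fin n → Fin n → ℕ
mutArr a k i j with i ≟ k | j ≟ k
... | yes _ | _     = a j i
... | no _  | yes _ = a j i
... | no _  | no _  = (a i j + a i k * a k j) ∸ (a j i + a j k * a k i)

private
  ∸-either : ∀ x y → x ∸ y ≡ 0 ⊎ y ∸ x ≡ 0
  ∸-either x y with ≤-total x y
  ... | inj₁ p = inj₁ (m≤n⇒m∸n≡0 p)
  ... | inj₂ p = inj₂ (m≤n⇒m∸n≡0 p)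

mutLoop : (Q : Quiver) (k : Fin (nv Q)) → ∀ i → mutArr (arr Q) k i i ≡ 0
mutLoop Q k i with i ≟ k
... | yes _ = loopfree Q i
... | no _  = n∸n≡0 (arr Q i i + arr Q i k * arr Q k i)

mut2 : (Q : Quiver) (k : Fin (nv Q)) → ∀ i j →
       mutArr (arr Q) k i j ≡ 0 ⊎ mutArr (arr Q) k j i ≡ 0
mut2 Q k i j with i ≟ k | j ≟ k
... | yes _ | yes _ = no2cyc Q j i
... | yes _ | no _  = no2cyc Q j i
... | no _  | yes _ = no2cyc Q j i
... | no _  | no _  =
  ∸-either (arr Q i j + arr Q i k * arr Q k j) (arr Q j i + arr Q j k * arr Q k i)

mutate : (Q : Quiver) → Fin (nv Q) → Quiver
mutate Q k = record
  { nv = nv Q ; nonempty = nonempty Q ; arr = mutArr (arr Q) k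
  ; loopfree = mutLoop Q k ; no2cyc = mut2 Q k }

data _⟶*_ : Quiver → Quiver → Set where
  done : ∀ {Q} → Q ⟶* Q
  step : ∀ {Q R} (k : Fin (nv Q)) → mutate Q k ⟶* R → Q ⟶* R

record _≅_ (P Q : Quiver) : Set where
  field
    σ     : Fin (nv P) ⤖ Fin (nv Q)
    presv : ∀ i j → arr P i j ≡ arr Q (Bijection.to σ i) (Bijection.to σ j)

_∼_ : Quiver → Quiver → Set
Q ∼ Q' = Σ Quiver λ R → (Q ⟶* R) × (R ≅ Q')

-- P is isomorphic to a full subquiver Q_I of Q (I = image of the injection f).
_⊑_ : Quiver → Quiver → Set
P ⊑ Q = Σ (Fin (nv P) → Fin (nv Q)) λ f →
          Injective _≡_ _≡_ f × (∀ i j → arr P i j ≡ arr Q (f i) (f j))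

-- Embedding of mutation classes [P] ⪯ [Q], on representatives.
_⪯_ : Quiver → Quiver → Set
P ⪯ Q = Σ Quiver λ P' → Σ Quiver λ Q' → (P ∼ P') × (Q ∼ Q') × (P' ⊑ Q')

-- Subsets of 𝓜 are predicates on quivers; closed (down-)sets and open (up-)sets
-- of the Alexandrov topology of ⪯.  (Both are automatically closed under ∼,
-- since Q ∼ Q' implies Q ⪯ Q' and Q' ⪯ Q, so they are genuine subsets of 𝓜.)
Subset𝓜 : Set₁
Subset𝓜 = Quiver → Set

IsClosed : Subset𝓜 → Set
IsClosed S = ∀ P Q → S Q → P ⪯ Q → S P

IsOpen : Subset𝓜 → Set
IsOpen U = ∀ P Q → U P → P ⪯ Q → U Q

InClosure : Subset𝓜 → Quiver → Set₁
InClosure A Q = (C : Subset𝓜) → IsClosed C → (∀ P → A P → C P) → C Q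

IsDense : Subset𝓜 → Set₁
IsDense A = ∀ Q → InClosure A Q

{-# OPTIONS --safe #-}
module Submission where

open import Defs
open import Data.Product using (∃; _×_; _,_)
open import Data.Nat using (ℕ; _+_)
open import Data.Nat.Properties using (≤-trans; m≤m+n)
open import Data.Fin using (Fin; splitAt; _↑ˡ_; _↑ʳ_)
open import Data.Fin.Properties using (splitAt-↑ˡ; splitAt-↑ʳ; ↑ˡ-injective; ↑ʳ-injective)
open import Data.Sum using (_⊎_; inj₁; inj₂)
open import Relation.Binary.PropositionalEquality using (_≡_; refl)
open import Function.Construct.Identity using (⤖-id)

-- Any two mutation classes embed into the class of the disjoint union of
-- representatives, so the embedding order is directed.  An open set is an
-- up-set, hence contains that common upper bound of a given point of it and
-- of an arbitrary Q; a closed set containing it is a down-set, hence contains Q.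

module DisjointUnion (P Q : Quiver) where

  arr⊎ : Fin (nv P) ⊎ Fin (nv Q) → Fin (nv P) ⊎ Fin (nv Q) → ℕ
  arr⊎ (inj₁ a) (inj₁ b) = arr P a b
  arr⊎ (inj₂ a) (inj₂ b) = arr Q a b
  arr⊎ (inj₁ _) (inj₂ _) = 0
  arr⊎ (inj₂ _) (inj₁ _) = 0

  arr⊎-loopfree : ∀ x → arr⊎ x x ≡ 0
  arr⊎-loopfree (inj₁ a) = loopfree P a
  arr⊎-loopfree (inj₂ a) = loopfree Q a

  arr⊎-no2cyc : ∀ x y → arr⊎ x y ≡ 0 ⊎ arr⊎ y x ≡ 0
  arr⊎-no2cyc (inj₁ a) (inj₁ b) = no2cyc P a b
  arr⊎-no2cyc (inj₂ a) (inj₂ b) = no2cyc Q a b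
  arr⊎-no2cyc (inj₁ _) (inj₂ _) = inj₁ refl
  arr⊎-no2cyc (inj₂ _) (inj₁ _) = inj₁ refl

  split : Fin (nv P + nv Q) → Fin (nv P) ⊎ Fin (nv Q)
  split = splitAt (nv P)

  _⊕_ : Quiver
  _⊕_ = record
    { nv       = nv P + nv Q
    ; nonempty = ≤-trans (nonempty P) (m≤m+n (nv P) (nv Q))
    ; arr      = λ i j → arr⊎ (split i) (split j)
    ; loopfree = λ i → arr⊎-loopfree (split i)
    ; no2cyc   = λ i j → arr⊎-no2cyc (split i) (split j)
    }

  ⊑-⊕ˡ : P ⊑ _⊕_
  ⊑-⊕ˡ = (_↑ˡ nv Q) , ↑ˡ-injective (nv Q) _ _ , preserves
    where
    preserves : ∀ a b → arr P a b ≡ arr _⊕_ (a ↑ˡ nv Q) (b ↑ˡ nv Q)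
    preserves a b rewrite splitAt-↑ˡ (nv P) a (nv Q) | splitAt-↑ˡ (nv P) b (nv Q) = refl

  ⊑-⊕ʳ : Q ⊑ _⊕_
  ⊑-⊕ʳ = (nv P ↑ʳ_) , ↑ʳ-injective (nv P) _ _ , preserves
    where
    preserves : ∀ a b → arr Q a b ≡ arr _⊕_ (nv P ↑ʳ a) (nv P ↑ʳ b)
    preserves a b rewrite splitAt-↑ʳ (nv P) (nv Q) a | splitAt-↑ʳ (nv P) (nv Q) b = refl

open DisjointUnion using (_⊕_; ⊑-⊕ˡ; ⊑-⊕ʳ)

∼-refl : ∀ Q → Q ∼ Q
∼-refl Q = Q , done , record { σ = ⤖-id _ ; presv = λ _ _ → refl }

⊑⇒⪯ : ∀ {P Q} → P ⊑ Q → P ⪯ Q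
⊑⇒⪯ {P} {Q} P⊑Q = P , Q , ∼-refl P , ∼-refl Q , P⊑Q

⪯-directed : ∀ P Q → ∃ λ R → P ⪯ R × Q ⪯ R
⪯-directed P Q = P ⊕ Q , ⊑⇒⪯ (⊑-⊕ˡ P Q) , ⊑⇒⪯ (⊑-⊕ʳ P Q)

InClosure-⪯ : ∀ {A P Q} → A Q → P ⪯ Q → InClosure A P
InClosure-⪯ {P = P} {Q} AQ P⪯Q C C-closed A⊆C = C-closed P Q (A⊆C Q AQ) P⪯Q

proposition3p8 : (U : Subset𝓜) → IsOpen U → ∃ U → IsDense U
proposition3p8 U U-open (P , UP) Q =
  let R , P⪯R , Q⪯R = ⪯-directed P Q
  in InClosure-⪯ (U-open P R UP P⪯R) Q⪯R
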